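{- Let $m,u$ be positive integers, $\mathcal{D}_m$ the set of positive divisors of $m$, and $H_{m,u}:\mathcal{D}_m\to\mathcal{D}_m$, $H_{m,u}(d)=d/\gcd(u,d)$. Then: (1) the image of $H_{m,u}$ is the set of positive divisors of $m/\gcd(u,m)$; (2) for $d'\in\mathcal{D}_m$, the preimage $H_{m,u}^{ -1}(d')$ equals $\{d\in\mathcal{D}_m : d=d_\perp u_\parallel d' \text{ for some } d_\perp\mid \gcd(m,u_\perp)\}$, where $u_\perp$ is the largest divisor of $u$ coprime to $d'$ (the product of all prime-power factors of $u$ whose primes do not divide $d'$) and $u_\parallel=u/u_\perp$. -}

module Defs where

open import Data.Nat using (ℕ; _≤_; NonZero; ≢-nonZero; ≢-nonZero⁻¹)
open import Data.Nat.DivMod using (_/_)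
open import Data.Nat.Divisibility using (_∣_)
open import Data.Nat.GCD using (gcd; gcd[m,n]≢0)
open import Data.Nat.Coprimality using (Coprime)
open import Data.Product using (_×_)
open import Data.Sum using (inj₁)

gcd-nonZero : ∀ u n → .{{NonZero u}} → NonZero (gcd u n)
gcd-nonZero u n = ≢-nonZero (gcd[m,n]≢0 u n (inj₁ (≢-nonZero⁻¹ u)))

H : (u d : ℕ) → .{{NonZero u}} → ℕ
H u d = _/_ d (gcd u d) {{gcd-nonZero u d}}

IsLargestCoprimeDivisor : (u d' a : ℕ) → Set
IsLargestCoprimeDivisor u d' a =
  a ∣ u × Coprime a d' × (∀ b → b ∣ u → Coprime b d' → b ≤ a)

module Submission where

-- Proof idea.  Write g = gcd u d, so that d = g * H u d (lemma H-spec) and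
-- H u d is the unique x with g * x = d (H-unique).
--
-- Multiplying by u turns H into an lcm: u * H u d = lcm u d
-- (u*H≡lcm).  Since lcm u _ is monotone for divisibility, d ∣ m gives
-- H u d ∣ H u m (H-mono).  Conversely every d' ∣ H u m is hit by the
-- divisor d' * gcd u m of m, whose gcd with u is still gcd u m (H-section).
--
-- If H u d = d', then u / g is coprime to d' (the cofactors of a
-- gcd are coprime), so it divides the largest divisor u⊥ of u coprime to d'
-- (largestCoprime-absorbs); writing u⊥ = t * (u / g) and cancelling in
-- u = g * (u / g) = u⊥ * u∥ gives g = t * u∥ with t ∣ u⊥ (gcd-on-fibre).
-- Conversely, if u⊥ is coprime to d' and t ∣ u⊥, then
-- gcd (u⊥ * u∥) (t * u∥ * d') = t * u∥, hence H u (t * u∥ * d') = d'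
-- (H-on-fibre-form).

open import Defs
open import Data.Nat using (ℕ; zero; suc; _*_; NonZero; ≢-nonZero⁻¹)
open import Data.Nat.Properties using (*-comm; *-identityʳ; *-commutativeSemigroup; *-cancelˡ-≡; *-cancelʳ-≡; ≤-antisym)
open import Data.Nat.Divisibility
open import Data.Nat.DivMod using (_/_; m*[n/m]≡n)
open import Data.Nat.GCD using (gcd; gcd[m,n]∣m; gcd[m,n]∣n; gcd-greatest; c*gcd[m,n]≡gcd[cm,cn])
open import Data.Nat.LCM using (lcm; m∣lcm[m,n]; n∣lcm[m,n]; lcm-least; gcd*lcm)
open import Data.Nat.Coprimality using (Coprime; coprime-divisor; coprime⇒gcd≡1; coprime-/gcd)
open import Data.Empty using (⊥-elim)
open import Data.Product using (_×_; ∃-syntax; _,_)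
open import Function.Bundles using (_⇔_; mk⇔)
open import Relation.Binary.PropositionalEquality
open import Algebra.Properties.CommutativeSemigroup *-commutativeSemigroup
  using (x∙yz≈y∙xz; xy∙z≈xz∙y; xy∙z≈y∙xz; xy∙z≈z∙yx)
open ≡-Reasoning

divisor-nonZero : ∀ {a n} .{{_ : NonZero n}} → a ∣ n → NonZero a
divisor-nonZero {zero}  {n} 0∣n = ⊥-elim (≢-nonZero⁻¹ n (0∣⇒≡0 0∣n))
divisor-nonZero {suc _}     _   = _

coprime-∣ˡ : ∀ {x y n} → x ∣ y → Coprime y n → Coprime x n
coprime-∣ˡ x∣y y⊥n (i∣x , i∣n) = y⊥n (∣-trans i∣x x∣y , i∣n)

coprime-* : ∀ {a b n} → Coprime a n → Coprime b n → Coprime (a * b) n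
coprime-* {a} {b} {n} a⊥n b⊥n {i} (i∣ab , i∣n) = b⊥n (coprime-divisor i⊥a i∣ab , i∣n)
  where
  i⊥a : Coprime i a
  i⊥a (j∣i , j∣a) = a⊥n (j∣a , ∣-trans j∣i i∣n)

gcd[ts,tn]≡t : ∀ t {s n} → Coprime s n → gcd (t * s) (t * n) ≡ t
gcd[ts,tn]≡t t {s} {n} s⊥n = begin
  gcd (t * s) (t * n)  ≡⟨ sym (c*gcd[m,n]≡gcd[cm,cn] t s n) ⟩
  t * gcd s n          ≡⟨ cong (t *_) (coprime⇒gcd≡1 s⊥n) ⟩
  t * 1                ≡⟨ *-identityʳ t ⟩
  t                    ∎

-- The largest divisor a of u coprime to d' is a multiple of every divisor b
-- of u coprime to d': lcm b a is again such a divisor, so lcm b a ≤ a, while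
-- a ∣ lcm b a forces lcm b a = a.
largestCoprime-absorbs : ∀ {u d' a b} .{{_ : NonZero u}} →
  IsLargestCoprimeDivisor u d' a → b ∣ u → Coprime b d' → b ∣ a
largestCoprime-absorbs {u} {d'} {a} {b} (a∣u , a⊥d' , a-max) b∣u b⊥d' =
  subst (b ∣_) lcm≡a (m∣lcm[m,n] b a)
  where
  lcm∣u : lcm b a ∣ u
  lcm∣u = lcm-least b∣u a∣u
  lcm⊥d' : Coprime (lcm b a) d'
  lcm⊥d' = coprime-∣ˡ (lcm-least (m∣m*n {b} a) (n∣m*n b)) (coprime-* b⊥d' a⊥d')
  instance
    lcm-nonZero : NonZero (lcm b a)
    lcm-nonZero = divisor-nonZero lcm∣u
  lcm≡a : lcm b a ≡ a
  lcm≡a = ≤-antisym (a-max (lcm b a) lcm∣u lcm⊥d') (∣⇒≤ (n∣lcm[m,n] b a))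

H-spec : ∀ u d .{{_ : NonZero u}} → gcd u d * H u d ≡ d
H-spec u d = m*[n/m]≡n {{gcd-nonZero u d}} (gcd[m,n]∣n u d)

H-unique : ∀ u d x .{{_ : NonZero u}} → gcd u d * x ≡ d → H u d ≡ x
H-unique u d x g*x≡d =
  *-cancelˡ-≡ (H u d) x (gcd u d) {{gcd-nonZero u d}} (trans (H-spec u d) (sym g*x≡d))

-- Up to the factor u, H u d is lcm u d, since gcd u d * lcm u d = u * d.
u*H≡lcm : ∀ u d .{{_ : NonZero u}} → u * H u d ≡ lcm u d
u*H≡lcm u d = *-cancelˡ-≡ (u * H u d) (lcm u d) (gcd u d) {{gcd-nonZero u d}} (begin
  gcd u d * (u * H u d)  ≡⟨ x∙yz≈y∙xz (gcd u d) u (H u d) ⟩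
  u * (gcd u d * H u d)  ≡⟨ cong (u *_) (H-spec u d) ⟩
  u * d                  ≡⟨ sym (gcd*lcm u d) ⟩
  gcd u d * lcm u d      ∎)

-- H u is monotone for divisibility, because lcm u is.
H-mono : ∀ u {d m} .{{_ : NonZero u}} → d ∣ m → H u d ∣ H u m
H-mono u {d} {m} d∣m =
  *-cancelˡ-∣ u (subst₂ _∣_ (sym (u*H≡lcm u d)) (sym (u*H≡lcm u m)) lcm∣lcm)
  where
  lcm∣lcm : lcm u d ∣ lcm u m
  lcm∣lcm = lcm-least (m∣lcm[m,n] u m) (∣-trans d∣m (n∣lcm[m,n] u m))

-- Every divisor d' of H u m is attained on the divisors of m, namely at
-- d' * gcd u m, whose gcd with u is still gcd u m.
H-section : ∀ u {m d'} .{{_ : NonZero u}} → d' ∣ H u m →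
  d' * gcd u m ∣ m × H u (d' * gcd u m) ≡ d'
H-section u {m} {d'} d'∣Hm =
  d'G∣m , H-unique u (d' * G) d' (trans (cong (_* d') gcd≡G) (*-comm G d'))
  where
  G = gcd u m
  d'G∣m : d' * G ∣ m
  d'G∣m = subst (d' * G ∣_) (trans (*-comm (H u m) G) (H-spec u m)) (*-monoˡ-∣ G d'∣Hm)
  gcd≡G : gcd u (d' * G) ≡ G
  gcd≡G = ∣-antisym
    (gcd-greatest (gcd[m,n]∣m u (d' * G)) (∣-trans (gcd[m,n]∣n u (d' * G)) d'G∣m))
    (gcd-greatest (gcd[m,n]∣m u m) (n∣m*n d'))

-- On the fibre of d', the gcd with u splits as t * u∥ with t ∣ u⊥: the
-- cofactor u / gcd u d is coprime to H u d = d', hence divides u⊥.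
gcd-on-fibre : ∀ {u d' u⊥ u∥} d .{{_ : NonZero u}} →
  IsLargestCoprimeDivisor u d' u⊥ → u ≡ u⊥ * u∥ → H u d ≡ d' →
  ∃[ t ] (t ∣ u⊥ × gcd u d ≡ t * u∥)
gcd-on-fibre {u} {d'} {u⊥} {u∥} d largest u≡u⊥u∥ Hd≡d' = t , t∣u⊥ , g≡tu∥
  where
  g = gcd u d
  instance
    g-nonZero : NonZero g
    g-nonZero = gcd-nonZero u d
  u' = u / g
  g*u'≡u : g * u' ≡ u
  g*u'≡u = m*[n/m]≡n (gcd[m,n]∣m u d)
  u'∣u : u' ∣ u
  u'∣u = divides g (sym g*u'≡u)
  u'∣u⊥ : u' ∣ u⊥
  u'∣u⊥ = largestCoprime-absorbs largest u'∣u (subst (Coprime u') Hd≡d' (coprime-/gcd u d))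
  t = quotient u'∣u⊥
  u⊥≡tu' : u⊥ ≡ t * u'
  u⊥≡tu' = _∣_.equality u'∣u⊥
  t∣u⊥ : t ∣ u⊥
  t∣u⊥ = divides u' (trans u⊥≡tu' (*-comm t u'))
  g≡tu∥ : g ≡ t * u∥
  g≡tu∥ = *-cancelʳ-≡ g (t * u∥) u' {{divisor-nonZero u'∣u}} (begin
    g * u'      ≡⟨ g*u'≡u ⟩
    u           ≡⟨ u≡u⊥u∥ ⟩
    u⊥ * u∥     ≡⟨ cong (_* u∥) u⊥≡tu' ⟩
    t * u' * u∥ ≡⟨ xy∙z≈xz∙y t u' u∥ ⟩
    t * u∥ * u' ∎)

-- Conversely, if u = u⊥ * u∥ with u⊥ coprime to d', then H u maps
-- t * u∥ * d' to d' for every t ∣ u⊥: writing u⊥ = s * t, the number s is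
-- coprime to d' and gcd u (t * u∥ * d') = u∥ * gcd (t * s) (t * d') = t * u∥.
H-on-fibre-form : ∀ {u d' u⊥ u∥ t} .{{_ : NonZero u}} →
  Coprime u⊥ d' → u ≡ u⊥ * u∥ → t ∣ u⊥ → H u (t * u∥ * d') ≡ d'
H-on-fibre-form {u} {d'} {u⊥} {u∥} {t} u⊥⊥d' u≡u⊥u∥ (divides s u⊥≡st) =
  H-unique u (t * u∥ * d') d' (cong (_* d') gcd≡tu∥)
  where
  s⊥d' : Coprime s d'
  s⊥d' = coprime-∣ˡ (divides t (trans u⊥≡st (*-comm s t))) u⊥⊥d'
  u≡u∥ts : u ≡ u∥ * (t * s)
  u≡u∥ts = begin
    u            ≡⟨ u≡u⊥u∥ ⟩
    u⊥ * u∥      ≡⟨ cong (_* u∥) u⊥≡st ⟩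
    s * t * u∥   ≡⟨ xy∙z≈z∙yx s t u∥ ⟩
    u∥ * (t * s) ∎
  gcd≡tu∥ : gcd u (t * u∥ * d') ≡ t * u∥
  gcd≡tu∥ = begin
    gcd u (t * u∥ * d')                 ≡⟨ cong₂ gcd u≡u∥ts (xy∙z≈y∙xz t u∥ d') ⟩
    gcd (u∥ * (t * s)) (u∥ * (t * d'))  ≡⟨ sym (c*gcd[m,n]≡gcd[cm,cn] u∥ (t * s) (t * d')) ⟩
    u∥ * gcd (t * s) (t * d')           ≡⟨ cong (u∥ *_) (gcd[ts,tn]≡t t s⊥d') ⟩
    u∥ * t                              ≡⟨ *-comm u∥ t ⟩
    t * u∥                              ∎

proposition4 : ∀ (m u : ℕ) .{{_ : NonZero m}} .{{_ : NonZero u}} →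
    (∀ d' → (∃[ d ] (d ∣ m × H u d ≡ d')) ⇔ (d' ∣ H u m))
    × (∀ d' → d' ∣ m → ∀ u⊥ u∥ → IsLargestCoprimeDivisor u d' u⊥ → u ≡ u⊥ * u∥ →
        ∀ d → (d ∣ m × H u d ≡ d') ⇔ (d ∣ m × ∃[ d⊥ ] (d⊥ ∣ gcd m u⊥ × d ≡ d⊥ * u∥ * d')))
proposition4 m u = image , fibre
  where
  image : ∀ d' → (∃[ d ] (d ∣ m × H u d ≡ d')) ⇔ (d' ∣ H u m)
  image d' = mk⇔ (λ (d , d∣m , Hd≡d') → subst (_∣ H u m) Hd≡d' (H-mono u d∣m))
                 (λ d'∣Hm → d' * gcd u m , H-section u d'∣Hm)

  fibre : ∀ d' → d' ∣ m → ∀ u⊥ u∥ → IsLargestCoprimeDivisor u d' u⊥ → u ≡ u⊥ * u∥ →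
    ∀ d → (d ∣ m × H u d ≡ d') ⇔ (d ∣ m × ∃[ d⊥ ] (d⊥ ∣ gcd m u⊥ × d ≡ d⊥ * u∥ * d'))
  fibre d' _ u⊥ u∥ largest@(_ , u⊥⊥d' , _) u≡u⊥u∥ d = mk⇔ to from
    where
    to : d ∣ m × H u d ≡ d' → d ∣ m × ∃[ d⊥ ] (d⊥ ∣ gcd m u⊥ × d ≡ d⊥ * u∥ * d')
    to (d∣m , Hd≡d') with gcd-on-fibre d largest u≡u⊥u∥ Hd≡d'
    ... | t , t∣u⊥ , g≡tu∥ = d∣m , t , gcd-greatest t∣m t∣u⊥ , d≡tu∥d'
      where
      t∣m : t ∣ m
      t∣m = ∣-trans (subst (t ∣_) (sym g≡tu∥) (m∣m*n u∥)) (∣-trans (gcd[m,n]∣n u d) d∣m)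
      d≡tu∥d' : d ≡ t * u∥ * d'
      d≡tu∥d' = trans (sym (H-spec u d)) (cong₂ _*_ g≡tu∥ Hd≡d')
    from : d ∣ m × ∃[ d⊥ ] (d⊥ ∣ gcd m u⊥ × d ≡ d⊥ * u∥ * d') → d ∣ m × H u d ≡ d'
    from (d∣m , t , t∣gcd , d≡tu∥d') = d∣m ,
      subst (λ x → H u x ≡ d') (sym d≡tu∥d')
            (H-on-fibre-form u⊥⊥d' u≡u⊥u∥ (∣-trans t∣gcd (gcd[m,n]∣n m u⊥)))
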